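{- Let $H = (V, E)$ be a static graph with vertices $v_1, \dots, v_n$ and $m$ edges, in which every vertex has degree at least $1$, and let $\mathcal{G} = (G_1, G_2)$ be the temporal graph constructed from $H$ as described in the context. Then for every integer $k \geq 0$, $\mathcal{G}$ admits a temporal sequence $2$-colouring of cost at most $k$ if and only if there exists a partition of $V$ into two colour classes such that at most $k$ edges of $E$ have both endpoints in the same class.
   Context: Construction of $\mathcal{G}$ from $H$: let $d_i$ be the degree of $v_i$ in $H$. For each $i$, create $2d_i - 1$ vertices $a_i^1, b_i^1, a_i^2, b_i^2, \dots, a_i^{d_i-1}, b_i^{d_i-1}, a_i^{d_i}$; the common vertex set of $\mathcal{G}$ consists of all these vertices. The snapshot $G_1$ consists, for each $i$, of the path $a_i^1 - b_i^1 - a_i^2 - b_i^2 - \cdots - b_i^{d_i-1} - a_i^{d_i}$ (the vertex gadget of $v_i$), and no other edges. For the snapshot $G_2$: for every vertex $v_i$ of $H$, fix an arbitrary enumeration $1, \dots, d_i$ of the edges of $H$ incident to $v_i$; for each edge $v_i v_j$ of $H$ that is the $p$-th edge of $v_i$ and the $q$-th edge of $v_j$, add the edge $a_i^p a_j^q$ to $G_2$; $G_2$ has no other edges (so it is a matching with $m$ edges). A temporal graph $(G_1, \dots, G_T)$ is a sequence of static graphs on a common vertex set. A temporal sequence $2$-colouring is a sequence $\psi_1, \dots, \psi_T$ where $\psi_t : V \to \{0,1\}$ is a proper colouring of $G_t$ (endpoints of each edge of $G_t$ receive different colours); its cost is the total number of pairs $(v, t)$, $1 \le t \le T-1$, with $\psi_t(v)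 \neq \psi_{t+1}(v)$. -}

module Defs where

open import Data.Nat using (ℕ; zero; suc; _+_; _*_; _∸_; _<_; _≤_)
open import Data.Fin using (Fin; toℕ; inject₁) renaming (zero to fzero; suc to fsuc)
open import Data.Bool using (Bool; true; false; if_then_else_)
open import Data.Product using (Σ; _×_; _,_; ∃; ∃-syntax; proj₁; proj₂)
open import Relation.Binary.PropositionalEquality using (_≡_; _≢_)
open import Relation.Nullary using (¬_; Dec; yes; no)
open import Relation.Nullary.Decidable using (⌊_⌋)
open import Data.Fin using (_≟_)
open import Data.Bool using () renaming (_≟_ to _≟B_)
open import Data.Vec.Functional using (Vector)

sumFin : (k : ℕ) → (Fin k → ℕ) → ℕ
sumFin zero    f = 0
sumFin (suc k) f = f fzero + sumFin k (λ i → f (fsuc i))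

countFin : (k : ℕ) → (Fin k → Bool) → ℕ
countFin k b = sumFin k (λ i → if b i then 1 else 0)

record Graph : Set where
  field
    n   : ℕ
    m   : ℕ
    src : Fin m → Fin n
    tgt : Fin m → Fin n

record IsSimple (H : Graph) : Set where
  open Graph H
  field
    loopless : ∀ e → src e ≢ tgt e
    noParallel : ∀ e e' →
      ((src e ≡ src e' × tgt e ≡ tgt e') → e ≡ e') ×
      ((src e ≡ tgt e' × tgt e ≡ src e') → e ≡ e')

module _ (H : Graph) where
  open Graph H

  Incident : Fin m → Fin n → Set
  Incident e i = (src e ≡ i) Data.Sum.⊎ (tgt e ≡ i)
    where import Data.Sum

  -- An enumeration 1..d_i of the edges incident to each vertex v_i:
  -- enum i : Fin (d i) → Fin m is a bijection onto the edges incident to i.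
  -- (Consequently d i is the degree of v_i.)
  record Enumeration : Set where
    field
      d     : Fin n → ℕ
      enum  : (i : Fin n) → Fin (d i) → Fin m
      inc   : ∀ i p → Incident (enum i p) i
      inj   : ∀ i p q → enum i p ≡ enum i q → p ≡ q
      surj  : ∀ i e → Incident e i → ∃[ p ] enum i p ≡ e

record TemporalGraph : Set₁ where
  field
    N    : ℕ
    T    : ℕ
    snap : Fin T → Fin N → Fin N → Set

Proper : {N : ℕ} → (Fin N → Fin N → Set) → (Fin N → Bool) → Set
Proper {N} G ψ = ∀ u w → G u w → ψ u ≢ ψ w

module _ (𝒢 : TemporalGraph) where
  open TemporalGraph 𝒢

  record TemporalColouring : Set where
    field
      ψ      : Fin T → Fin N → Bool
      proper : ∀ t → Proper (snap t) (ψ t)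

  -- cost: number of pairs (v,t), t < T-1 (0-based), with ψ_t v ≠ ψ_{t+1} v
  cost : (Fin T → Fin N → Bool) → ℕ
  cost ψ = go T ψ
    where
    changes : {k : ℕ} → (Fin (suc (suc k)) → Fin N → Bool) → ℕ
    changes ψ' = countFin N (λ v → if ⌊ ψ' fzero v ≟B ψ' (fsuc fzero) v ⌋ then false else true)
    go : (k : ℕ) → (Fin k → Fin N → Bool) → ℕ
    go zero          ψ' = 0
    go (suc zero)    ψ' = 0
    go (suc (suc k)) ψ' = changes {k} ψ' + go (suc k) (λ t → ψ' (fsuc t))

-- The gadget of v_i has 2 d_i - 1 vertices, listed (0-based) as
-- position 0 = a_i^1, 1 = b_i^1, 2 = a_i^2, ..., 2(d_i - 1) = a_i^{d_i};
-- i.e. a_i^p sits at position 2(p-1) and b_i^p at position 2p-1.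
-- The gadgets are laid out consecutively in Fin N, N = Σ_i (2 d_i - 1).

module Construction (H : Graph) (E : Enumeration H) where
  open Graph H
  open Enumeration E

  gsize : Fin n → ℕ
  gsize i = 2 * d i ∸ 1

  N : ℕ
  N = sumFin n gsize

  offset : Fin n → ℕ
  offset i = sumFin (toℕ i) (λ j → gsize (Data.Fin.inject≤ j (Data.Nat.Properties.<⇒≤ (Data.Fin.Properties.toℕ<n i))))
    where import Data.Fin
          import Data.Nat.Properties
          import Data.Fin.Properties

  idx : Fin n → ℕ → ℕ
  idx i k = offset i + k

  G₁ : Fin N → Fin N → Set
  G₁ u w = Σ (Fin n) λ i → Σ ℕ λ k → (suc k < gsize i) ×
           (toℕ u ≡ idx i k) × (toℕ w ≡ idx i (suc k))

  -- G_2: for each edge e = v_i v_j, which is the p-th edge of v_i and the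
  -- q-th edge of v_j, the edge a_i^p a_j^q  (positions 2p, 2q 0-based)
  G₂ : Fin N → Fin N → Set
  G₂ u w = Σ (Fin m) λ e → Σ (Fin (d (src e))) λ p → Σ (Fin (d (tgt e))) λ q →
           (enum (src e) p ≡ e) × (enum (tgt e) q ≡ e) ×
           (toℕ u ≡ idx (src e) (2 * toℕ p)) × (toℕ w ≡ idx (tgt e) (2 * toℕ q))

  𝒢 : TemporalGraph
  𝒢 = record { N = N ; T = 2 ; snap = λ { fzero → G₁ ; (fsuc fzero) → G₂ } }

monochromatic : (H : Graph) → (Fin (Graph.n H) → Bool) → ℕ
monochromatic H c = countFin m (λ e → ⌊ c (src e) ≟B c (tgt e) ⌋)
  where open Graph H

{-# OPTIONS --safe #-}

-- In a proper colouring of G₁ the path of v_i alternates, so all its a-vertices share one colour: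
-- this colours H.  For an edge v_i v_j that is monochromatic in this colouring, the G₂-edge
-- a_i^p a_j^q joins two vertices of equal G₁-colour, so one of its two endpoints must change colour;
-- as G₂ is a matching, distinct edges have distinct endpoints, and the cost is at least the number
-- of monochromatic edges.  Conversely, given a colouring c of H, colour the path of v_i alternately
-- starting with c(v_i) in G₁, and in G₂ recolour exactly the source endpoint of every monochromatic
-- edge.  Since H has no loops, each G₂-edge then gets two colours, at the cost of one change per
-- monochromatic edge.

module Submission where

open import Defs
open import Data.Nat using (ℕ; _≤_; _≥_)
open import Data.Fin using (Fin)
open import Data.Bool using (Bool)
open import Data.Product using (Σ; _×_; ∃-syntax)
open import Function.Bundles using (_⇔_)

open import Data.Nat using (zero; suc; _+_; _*_; _∸_; _<_; z≤n; s≤s; s≤s⁻¹; _<?_)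
open import Data.Nat.Properties
  using ( +-suc; +-assoc; +-identityʳ; +-cancelˡ-≡; +-monoʳ-<; *-suc; *-monoʳ-≤; *-cancelˡ-≡
        ; m≤m+n; m+n∸m≡n; m+[n∸m]≡n; ∸-monoˡ-≤; ∸-monoˡ-<; n<1+n
        ; ≤-trans; <-trans; ≤-<-trans; <-≤-trans; <⇒≱; ≮⇒≥ )
open import Data.Fin using (toℕ; fromℕ<; inject≤) renaming (zero to fzero; suc to fsuc)
open import Data.Fin.Properties using (toℕ<n; toℕ-fromℕ<; toℕ-injective; suc-injective; any?; _≟_)
open import Data.Bool using (true; false; not; _xor_; if_then_else_; T) renaming (_≟_ to _≟B_)
open import Data.Bool.Properties using (¬-not; not-¬; not-involutive; not-distribʳ-xor; xor-identityʳ)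
open import Data.Product using (_,_; proj₁; proj₂)
open import Data.Sum using (_⊎_; inj₁; inj₂)
open import Data.Unit using (tt)
open import Function using (_∘_)
open import Function.Bundles using (mk⇔; Equivalence)
open import Relation.Nullary using (Dec; yes; no; does; ¬_; contradiction)
open import Relation.Nullary.Decidable
  using (⌊_⌋; _×-dec_; toWitness; fromWitness; isYes≗does; does-⇔; dec-false)
open import Relation.Binary.PropositionalEquality

-- Uses does rather than ⌊_⌋, so that (Q ─ fsuc y) ∘ fsuc reduces to (Q ∘ fsuc) ─ y.
_─_ : ∀ {N} → (Fin N → Bool) → Fin N → Fin N → Bool
(Q ─ y) w = if does (w ≟ y) then false else Q w

─-≢ : ∀ {N} (Q : Fin N → Bool) {y w} → w ≢ y → (Q ─ y) w ≡ Q w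
─-≢ Q {y} {w} w≢y with w ≟ y
... | yes w≡y = contradiction w≡y w≢y
... | no _    = refl

countFin-─ : ∀ {N} (Q : Fin N → Bool) y → T (Q y) → countFin N Q ≡ suc (countFin N (Q ─ y))
countFin-─ Q fzero Qy with Q fzero
... | true = refl
countFin-─ {suc N} Q (fsuc y) Qy =
  trans (cong ((if Q fzero then 1 else 0) +_) (countFin-─ (Q ∘ fsuc) y Qy)) (+-suc _ _)

countFin-≤-injection : ∀ {m N} (P : Fin m → Bool) (Q : Fin N → Bool) (R : Fin m → Fin N → Set) →
  (∀ x → T (P x) → ∃[ y ] T (Q y) × R x y) →
  (∀ {x x′ y} → R x y → R x′ y → x ≡ x′) →
  countFin m P ≤ countFin N Q
countFin-≤-injection {zero} P Q R has R-injective = z≤n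
countFin-≤-injection {suc m} P Q R has R-injective with P fzero in P0
... | false = countFin-≤-injection (P ∘ fsuc) Q (R ∘ fsuc) (has ∘ fsuc)
                (λ r r′ → suc-injective (R-injective r r′))
... | true with has fzero (subst T (sym P0) tt)
...   | y , Qy , Ry = subst (suc (countFin m (P ∘ fsuc)) ≤_) (sym (countFin-─ Q y Qy))
                        (s≤s (countFin-≤-injection (P ∘ fsuc) (Q ─ y) (R ∘ fsuc) has-─
                                (λ r r′ → suc-injective (R-injective r r′))))
  where
  has-─ : ∀ x → T (P (fsuc x)) → ∃[ y′ ] T ((Q ─ y) y′) × R (fsuc x) y′
  has-─ x Px with has (fsuc x) Px
  ... | y′ , Qy′ , Ry′ = y′ , subst T (sym (─-≢ Q y′≢y)) Qy′ , Ry′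
    where
    y′≢y : y′ ≢ y
    y′≢y refl with () ← R-injective Ry′ Ry

blockStart : ∀ {n} → (Fin n → ℕ) → Fin n → ℕ
blockStart g fzero    = 0
blockStart g (fsuc i) = g fzero + blockStart (g ∘ fsuc) i

sumFin-inject≤≡blockStart : ∀ {n} (g : Fin n → ℕ) i .(i≤n : toℕ i ≤ n) →
  sumFin (toℕ i) (λ j → g (inject≤ j i≤n)) ≡ blockStart g i
sumFin-inject≤≡blockStart g fzero    i≤n = refl
sumFin-inject≤≡blockStart g (fsuc i) i≤n =
  cong (g fzero +_) (sumFin-inject≤≡blockStart (g ∘ fsuc) i (s≤s⁻¹ i≤n))

blockStart+<sumFin : ∀ {n} (g : Fin n → ℕ) i {k} → k < g i → blockStart g i + k < sumFin n g
blockStart+<sumFin g fzero    k<g = <-≤-trans k<g (m≤m+n _ _)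
blockStart+<sumFin g (fsuc i) {k} k<g =
  subst (_< sumFin _ g) (sym (+-assoc (g fzero) _ k))
        (+-monoʳ-< (g fzero) (blockStart+<sumFin (g ∘ fsuc) i k<g))

blockStart+-injective : ∀ {n} (g : Fin n → ℕ) {i j k l} → k < g i → l < g j →
  blockStart g i + k ≡ blockStart g j + l → i ≡ j × k ≡ l
blockStart+-injective g {fzero}  {fzero}  k<g l<g eq = refl , eq
blockStart+-injective g {fzero}  {fsuc j} k<g l<g eq =
  contradiction (subst (g fzero ≤_) (sym eq) (≤-trans (m≤m+n _ _) (m≤m+n _ _))) (<⇒≱ k<g)
blockStart+-injective g {fsuc i} {fzero}  k<g l<g eq =
  contradiction (subst (g fzero ≤_) eq (≤-trans (m≤m+n _ _) (m≤m+n _ _))) (<⇒≱ l<g)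
blockStart+-injective g {fsuc i} {fsuc j} {k} {l} k<g l<g eq
  with blockStart+-injective (g ∘ fsuc) k<g l<g
         (+-cancelˡ-≡ (g fzero) _ _
           (trans (sym (+-assoc (g fzero) _ k)) (trans eq (+-assoc (g fzero) _ l))))
... | refl , k≡l = refl , k≡l

locateBlock : ∀ {n} (g : Fin n → ℕ) v → v < sumFin n g → ∃[ i ] ∃[ k ] k < g i × v ≡ blockStart g i + k
locateBlock {suc n} g v v<sum with v <? g fzero
... | yes v<g = fzero , v , v<g , refl
... | no v≮g
  with locateBlock (g ∘ fsuc) (v ∸ g fzero)
         (subst (v ∸ g fzero <_) (m+n∸m≡n (g fzero) _) (∸-monoˡ-< v<sum (≮⇒≥ v≮g)))
...   | i , k , k<g , eq = fsuc i , k , k<g , (begin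
  v                                         ≡⟨ sym (m+[n∸m]≡n (≮⇒≥ v≮g)) ⟩
  g fzero + (v ∸ g fzero)                   ≡⟨ cong (g fzero +_) eq ⟩
  g fzero + (blockStart (g ∘ fsuc) i + k)   ≡⟨ sym (+-assoc (g fzero) _ k) ⟩
  g fzero + blockStart (g ∘ fsuc) i + k     ∎)
  where open ≡-Reasoning

odd : ℕ → Bool
odd zero    = false
odd (suc n) = not (odd n)

odd-2* : ∀ p → odd (2 * p) ≡ false
odd-2* zero    = refl
odd-2* (suc p) = trans (cong odd (*-suc 2 p)) (trans (not-involutive _) (odd-2* p))

m<n⇒2*m<2*n∸1 : ∀ {m n} → m < n → 2 * m < 2 * n ∸ 1
m<n⇒2*m<2*n∸1 {m} {n} m<n = ∸-monoˡ-≤ 1 (subst (_≤ 2 * n) (*-suc 2 m) (*-monoʳ-≤ 2 m<n))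

T-changed : ∀ {a b} → T (if ⌊ a ≟B b ⌋ then false else true) ⇔ (a ≢ b)
T-changed {a} {b} with a ≟B b
... | yes a≡b = mk⇔ (λ ()) (λ a≢b → a≢b a≡b)
... | no a≢b  = mk⇔ (λ _ → a≢b) _

≡-≢⇒≢⊎≢ : ∀ {a b a′ b′ : Bool} → a ≡ b → a′ ≢ b′ → a ≢ a′ ⊎ b ≢ b′
≡-≢⇒≢⊎≢ {a} {a′ = a′} refl a′≢b′ with a ≟B a′
... | yes refl = inj₂ a′≢b′
... | no a≢a′   = inj₁ a≢a′

xor-≢⇒T : ∀ a b → a ≢ a xor b → T b
xor-≢⇒T a false a≢a = a≢a (sym (xor-identityʳ a))
xor-≢⇒T a true  _   = tt

xor-does-≢ : ∀ a b → a xor does (a ≟B b) ≢ b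
xor-does-≢ false false ()
xor-does-≢ false true  ()
xor-does-≢ true  false ()
xor-does-≢ true  true  ()

module Gadgets (H : Graph) (E : Enumeration H) where
  open Graph H
  open Enumeration E
  open Construction H E

  idx≡blockStart : ∀ i k → idx i k ≡ blockStart gsize i + k
  idx≡blockStart i k = cong (_+ k) (sumFin-inject≤≡blockStart gsize i _)

  idx-injective : ∀ {i j k l} → k < gsize i → l < gsize j → idx i k ≡ idx j l → i ≡ j × k ≡ l
  idx-injective {i} {j} {k} {l} k< l< eq =
    blockStart+-injective gsize k< l< (trans (sym (idx≡blockStart i k)) (trans eq (idx≡blockStart j l)))

  vertex : (i : Fin n) (k : ℕ) → .(k < gsize i) → Fin N
  vertex i k k< = fromℕ< (subst (_< N) (sym (idx≡blockStart i k)) (blockStart+<sumFin gsize i k<))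

  toℕ-vertex : ∀ i k .(k< : k < gsize i) → toℕ (vertex i k k<) ≡ idx i k
  toℕ-vertex i k k< = toℕ-fromℕ< _

  locate : (v : Fin N) → ∃[ i ] ∃[ k ] k < gsize i × toℕ v ≡ idx i k
  locate v with locateBlock gsize (toℕ v) (toℕ<n v)
  ... | i , k , k< , eq = i , k , k< , trans eq (sym (idx≡blockStart i k))

  colourByPosition : (Fin n → ℕ → Bool) → Fin N → Bool
  colourByPosition f v = f (proj₁ (locate v)) (proj₁ (proj₂ (locate v)))

  colourByPosition-idx : ∀ f {v i k} → k < gsize i → toℕ v ≡ idx i k → colourByPosition f v ≡ f i k
  colourByPosition-idx f {v} k< v≡ =
    let _ , _ , k′< , v≡′ = locate v
        i′≡i , k′≡k = idx-injective k′< k< (trans (sym v≡′) v≡)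
    in cong₂ f i′≡i k′≡k

  G₁-step : ∀ i k (k+1< : suc k < gsize i) →
    G₁ (vertex i k (<-trans (n<1+n k) k+1<)) (vertex i (suc k) k+1<)
  G₁-step i k k+1< = i , k , k+1< , toℕ-vertex i k (<-trans (n<1+n k) k+1<) , toℕ-vertex i (suc k) k+1<

  Proper-G₁⇒alternating : ∀ {ψ} → Proper G₁ ψ → ∀ i .(0< : 0 < gsize i) k (k< : k < gsize i) →
    ψ (vertex i k k<) ≡ ψ (vertex i 0 0<) xor odd k
  Proper-G₁⇒alternating ψ-proper i 0< zero    k< = sym (xor-identityʳ _)
  Proper-G₁⇒alternating {ψ} ψ-proper i 0< (suc k) k+1< = begin
    ψ (vertex i (suc k) k+1<)         ≡⟨ ¬-not (≢-sym (ψ-proper _ _ (G₁-step i k k+1<))) ⟩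
    not (ψ (vertex i k k<))           ≡⟨ cong not (Proper-G₁⇒alternating ψ-proper i 0< k k<) ⟩
    not (ψ (vertex i 0 0<) xor odd k) ≡⟨ not-distribʳ-xor (ψ (vertex i 0 0<)) (odd k) ⟩
    ψ (vertex i 0 0<) xor odd (suc k) ∎
    where
    open ≡-Reasoning
    k< = <-trans (n<1+n k) k+1<

  2*toℕ<gsize : ∀ i (p : Fin (d i)) → 2 * toℕ p < gsize i
  2*toℕ<gsize i p = m<n⇒2*m<2*n∸1 (toℕ<n p)

  -- port i p is the vertex a_i^(p+1), the G₂-endpoint of the (p+1)-th edge at v_i.
  port : (i : Fin n) → Fin (d i) → Fin N
  port i p = vertex i (2 * toℕ p) (2*toℕ<gsize i p)

  toℕ-port : ∀ i p → toℕ (port i p) ≡ idx i (2 * toℕ p)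
  toℕ-port i p = toℕ-vertex i (2 * toℕ p) (2*toℕ<gsize i p)

  Proper-G₁⇒ports-agree : ∀ {ψ} → Proper G₁ ψ → ∀ i p q → ψ (port i p) ≡ ψ (port i q)
  Proper-G₁⇒ports-agree {ψ} ψ-proper i p q = trans (port≡first p) (sym (port≡first q))
    where
    0< : 0 < gsize i
    0< = ≤-<-trans z≤n (2*toℕ<gsize i p)
    port≡first : ∀ p → ψ (port i p) ≡ ψ (vertex i 0 0<)
    port≡first p = begin
      ψ (port i p)                           ≡⟨ Proper-G₁⇒alternating ψ-proper i 0< (2 * toℕ p) (2*toℕ<gsize i p) ⟩
      ψ (vertex i 0 0<) xor odd (2 * toℕ p)  ≡⟨ cong (ψ (vertex i 0 0<) xor_) (odd-2* (toℕ p)) ⟩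
      ψ (vertex i 0 0<) xor false            ≡⟨ xor-identityʳ _ ⟩
      ψ (vertex i 0 0<)                      ∎
      where open ≡-Reasoning

  indexAt : ∀ {e i} → Incident H e i → Fin (d i)
  indexAt {e} {i} e~i = proj₁ (surj i e e~i)

  enum-indexAt : ∀ {e i} (e~i : Incident H e i) → enum i (indexAt e~i) ≡ e
  enum-indexAt {e} {i} e~i = proj₂ (surj i e e~i)

  portAt : ∀ {e i} → Incident H e i → Fin N
  portAt {i = i} e~i = port i (indexAt e~i)

  portAt-injective : ∀ {e e′ i j} (e~i : Incident H e i) (e′~j : Incident H e′ j) →
    portAt e~i ≡ portAt e′~j → e ≡ e′ × i ≡ j
  portAt-injective {e} {e′} {i} {j} e~i e′~j eq
    with idx-injective (2*toℕ<gsize i (indexAt e~i)) (2*toℕ<gsize j (indexAt e′~j))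
           (trans (sym (toℕ-port i (indexAt e~i))) (trans (cong toℕ eq) (toℕ-port j (indexAt e′~j))))
  ... | refl , 2p≡2q = (begin
    e                     ≡⟨ sym (enum-indexAt e~i) ⟩
    enum i (indexAt e~i)  ≡⟨ cong (enum i) (toℕ-injective (*-cancelˡ-≡ _ _ 2 2p≡2q)) ⟩
    enum i (indexAt e′~j) ≡⟨ enum-indexAt e′~j ⟩
    e′                    ∎) , refl
    where open ≡-Reasoning

  toℕ≡idx⇒≡portAt : ∀ {v e i p} (e~i : Incident H e i) →
    enum i p ≡ e → toℕ v ≡ idx i (2 * toℕ p) → v ≡ portAt e~i
  toℕ≡idx⇒≡portAt {v} {i = i} {p} e~i ep≡e v≡ = toℕ-injective (begin
    toℕ v                          ≡⟨ v≡ ⟩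
    idx i (2 * toℕ p)              ≡⟨ cong (λ q → idx i (2 * toℕ q)) p≡indexAt ⟩
    idx i (2 * toℕ (indexAt e~i))  ≡⟨ sym (toℕ-port i (indexAt e~i)) ⟩
    toℕ (portAt e~i)               ∎)
    where
    open ≡-Reasoning
    p≡indexAt : p ≡ indexAt e~i
    p≡indexAt = inj i p (indexAt e~i) (trans ep≡e (sym (enum-indexAt e~i)))

  srcPort tgtPort : Fin m → Fin N
  srcPort e = portAt {e} (inj₁ refl)
  tgtPort e = portAt {e} (inj₂ refl)

  G₂-ports : ∀ e → G₂ (srcPort e) (tgtPort e)
  G₂-ports e = e , indexAt (inj₁ refl) , indexAt (inj₂ refl) , enum-indexAt _ , enum-indexAt _ ,
               toℕ-port (src e) (indexAt (inj₁ refl)) , toℕ-port (tgt e) (indexAt (inj₂ refl))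

  G₂⇒ports : ∀ {u w} → G₂ u w → ∃[ e ] u ≡ srcPort e × w ≡ tgtPort e
  G₂⇒ports (e , p , q , ep≡e , eq≡e , u≡ , w≡) =
    e , toℕ≡idx⇒≡portAt (inj₁ refl) ep≡e u≡ , toℕ≡idx⇒≡portAt (inj₂ refl) eq≡e w≡

  IsPortOf : Fin m → Fin N → Set
  IsPortOf e v = ∃[ i ] Σ (Incident H e i) λ e~i → portAt e~i ≡ v

  cost≡countChanges : (ψ : Fin 2 → Fin N → Bool) →
    cost 𝒢 ψ ≡ countFin N (λ v → if ⌊ ψ fzero v ≟B ψ (fsuc fzero) v ⌋ then false else true)
  cost≡countChanges ψ = +-identityʳ _

module FromTemporalColouring (H : Graph) (E : Enumeration H) (d≥1 : ∀ i → Enumeration.d E i ≥ 1)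
                             (Ψ : TemporalColouring (Construction.𝒢 H E)) where
  open Graph H
  open Enumeration E
  open Construction H E
  open Gadgets H E
  open TemporalColouring Ψ

  ψ₁ ψ₂ : Fin N → Bool
  ψ₁ = ψ fzero
  ψ₂ = ψ (fsuc fzero)

  partition : Fin n → Bool
  partition i = ψ₁ (port i (fromℕ< (d≥1 i)))

  ψ₁-port : ∀ i p → ψ₁ (port i p) ≡ partition i
  ψ₁-port i p = Proper-G₁⇒ports-agree (proper fzero) i p (fromℕ< (d≥1 i))

  monochromatic⇒changedPort : ∀ e → T ⌊ partition (src e) ≟B partition (tgt e) ⌋ →
    ∃[ v ] T (if ⌊ ψ₁ v ≟B ψ₂ v ⌋ then false else true) × IsPortOf e v
  monochromatic⇒changedPort e mono with ≡-≢⇒≢⊎≢ ψ₁-agrees (proper (fsuc fzero) _ _ (G₂-ports e))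
    where
    ψ₁-agrees : ψ₁ (srcPort e) ≡ ψ₁ (tgtPort e)
    ψ₁-agrees = begin
      ψ₁ (srcPort e)    ≡⟨ ψ₁-port (src e) (indexAt (inj₁ refl)) ⟩
      partition (src e) ≡⟨ toWitness mono ⟩
      partition (tgt e) ≡⟨ ψ₁-port (tgt e) (indexAt (inj₂ refl)) ⟨
      ψ₁ (tgtPort e)    ∎
      where open ≡-Reasoning
  ... | inj₁ src-changed = srcPort e , Equivalence.from T-changed src-changed , src e , inj₁ refl , refl
  ... | inj₂ tgt-changed = tgtPort e , Equivalence.from T-changed tgt-changed , tgt e , inj₂ refl , refl

  monochromatic≤cost : monochromatic H partition ≤ cost 𝒢 ψ
  monochromatic≤cost = subst (monochromatic H partition ≤_) (sym (cost≡countChanges ψ))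
    (countFin-≤-injection _ _ IsPortOf monochromatic⇒changedPort
      λ { (_ , e~i , refl) (_ , e′~j , v≡) → proj₁ (portAt-injective e~i e′~j (sym v≡)) })

module FromPartition (H : Graph) (simple : IsSimple H) (E : Enumeration H)
                     (c : Fin (Graph.n H) → Bool) where
  open Graph H
  open IsSimple simple
  open Enumeration E
  open Construction H E
  open Gadgets H E

  Monochromatic : Fin m → Set
  Monochromatic e = c (src e) ≡ c (tgt e)

  monochromatic? : ∀ e → Dec (Monochromatic e)
  monochromatic? e = c (src e) ≟B c (tgt e)

  IsFlipped : Fin N → Set
  IsFlipped v = ∃[ e ] Monochromatic e × v ≡ srcPort e

  isFlipped? : ∀ v → Dec (IsFlipped v)
  isFlipped? v = any? λ e → monochromatic? e ×-dec v ≟ srcPort e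

  flipped : Fin N → Bool
  flipped v = ⌊ isFlipped? v ⌋

  alternating : Fin n → ℕ → Bool
  alternating i k = c i xor odd k

  ψ₁ ψ₂ : Fin N → Bool
  ψ₁ = colourByPosition alternating
  ψ₂ v = ψ₁ v xor flipped v

  ψ₁-port : ∀ i p → ψ₁ (port i p) ≡ c i
  ψ₁-port i p = begin
    ψ₁ (port i p)            ≡⟨ colourByPosition-idx alternating (2*toℕ<gsize i p) (toℕ-port i p) ⟩
    c i xor odd (2 * toℕ p)  ≡⟨ cong (c i xor_) (odd-2* (toℕ p)) ⟩
    c i xor false            ≡⟨ xor-identityʳ (c i) ⟩
    c i                      ∎
    where open ≡-Reasoning

  flipped-srcPort : ∀ e → flipped (srcPort e) ≡ does (monochromatic? e)
  flipped-srcPort e = trans (isYes≗does (isFlipped? (srcPort e)))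
                            (does-⇔ (mk⇔ from to) (isFlipped? (srcPort e)) (monochromatic? e))
    where
    from : IsFlipped (srcPort e) → Monochromatic e
    from (e′ , mono , eq) with portAt-injective (inj₁ refl) (inj₁ refl) eq
    ... | refl , _ = mono
    to : Monochromatic e → IsFlipped (srcPort e)
    to mono = e , mono , refl

  flipped-tgtPort : ∀ e → flipped (tgtPort e) ≡ false
  flipped-tgtPort e =
    trans (isYes≗does (isFlipped? (tgtPort e))) (dec-false (isFlipped? (tgtPort e)) unflipped)
    where
    unflipped : ¬ IsFlipped (tgtPort e)
    unflipped (e′ , _ , eq) with portAt-injective (inj₂ refl) (inj₁ refl) eq
    ... | refl , tgt≡src = loopless e (sym tgt≡src)

  ψ₁-proper : Proper G₁ ψ₁
  ψ₁-proper u w (i , k , k+1< , u≡ , w≡) ψ₁u≡ψ₁w = not-¬ refl (trans ψ₁u≡ψ₁w ψ₁w≡not)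
    where
    ψ₁w≡not : ψ₁ w ≡ not (ψ₁ u)
    ψ₁w≡not = begin
      ψ₁ w                  ≡⟨ colourByPosition-idx alternating k+1< w≡ ⟩
      c i xor not (odd k)   ≡⟨ sym (not-distribʳ-xor (c i) (odd k)) ⟩
      not (c i xor odd k)   ≡⟨ cong not (colourByPosition-idx alternating (<-trans (n<1+n k) k+1<) u≡) ⟨
      not (ψ₁ u)            ∎
      where open ≡-Reasoning

  ψ₂-srcPort : ∀ e → ψ₂ (srcPort e) ≡ c (src e) xor does (monochromatic? e)
  ψ₂-srcPort e = cong₂ _xor_ (ψ₁-port (src e) (indexAt (inj₁ refl))) (flipped-srcPort e)

  ψ₂-tgtPort : ∀ e → ψ₂ (tgtPort e) ≡ c (tgt e)
  ψ₂-tgtPort e =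
    trans (cong₂ _xor_ (ψ₁-port (tgt e) (indexAt (inj₂ refl))) (flipped-tgtPort e)) (xor-identityʳ (c (tgt e)))

  ψ₂-proper : Proper G₂ ψ₂
  ψ₂-proper u w u~w with G₂⇒ports u~w
  ... | e , refl , refl = λ ψ₂≡ → xor-does-≢ (c (src e)) (c (tgt e)) (begin
    c (src e) xor does (monochromatic? e)  ≡⟨ ψ₂-srcPort e ⟨
    ψ₂ (srcPort e)                         ≡⟨ ψ₂≡ ⟩
    ψ₂ (tgtPort e)                         ≡⟨ ψ₂-tgtPort e ⟩
    c (tgt e)                              ∎)
    where open ≡-Reasoning

  colouring : TemporalColouring 𝒢
  colouring = record
    { ψ      = λ { fzero → ψ₁ ; (fsuc fzero) → ψ₂ }
    ; proper = λ { fzero → ψ₁-proper ; (fsuc fzero) → ψ₂-proper }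
    }

  changed⇒flippedSrcPort : ∀ v → T (if ⌊ ψ₁ v ≟B ψ₂ v ⌋ then false else true) →
    ∃[ e ] T ⌊ monochromatic? e ⌋ × v ≡ srcPort e
  changed⇒flippedSrcPort v changed =
    let e , mono , v≡ = toWitness (xor-≢⇒T (ψ₁ v) (flipped v) (Equivalence.to T-changed changed))
    in e , fromWitness mono , v≡

  cost≤monochromatic : cost 𝒢 (TemporalColouring.ψ colouring) ≤ monochromatic H c
  cost≤monochromatic = subst (_≤ monochromatic H c) (sym (cost≡countChanges (TemporalColouring.ψ colouring)))
    (countFin-≤-injection _ _ (λ v e → v ≡ srcPort e) changed⇒flippedSrcPort
      (λ v≡ v′≡ → trans v≡ (sym v′≡)))

lemma1 : (H : Graph) → IsSimple H → (E : Enumeration H) →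
           (∀ i → Enumeration.d E i ≥ 1) → (k : ℕ) →
           (Σ (TemporalColouring (Construction.𝒢 H E)) λ Ψ →
              cost (Construction.𝒢 H E) (TemporalColouring.ψ Ψ) ≤ k)
           ⇔ (∃[ c ] monochromatic H c ≤ k)
lemma1 H simple E d≥1 k = mk⇔
  (λ (Ψ , cost≤k) → partition Ψ , ≤-trans (monochromatic≤cost Ψ) cost≤k)
  (λ (c , monochromatic≤k) → colouring c , ≤-trans (cost≤monochromatic c) monochromatic≤k)
  where
  open FromTemporalColouring H E d≥1 using (partition; monochromatic≤cost)
  open FromPartition H simple E using (colouring; cost≤monochromatic)
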